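{- Let $G$ be a split graph with a fixed partition of $V(G)$ into a clique $C(G)$ and an independent set $I(G)$, and let $P$ be the characteristic poset of $G$. Then $\dim(P)\le t(\overline{G})$, where $\overline{G}$ is the complement of $G$.
   Context: All graphs are finite, simple and undirected; $N(u,G)$ denotes the set of neighbours of $u$ in $G$. A split graph is a graph whose vertex set can be partitioned into a clique and an independent set. The characteristic poset of the split graph $G$ (with respect to the partition $C(G),I(G)$) is $P=(\mathcal{S}(G),\subseteq)$ where $\mathcal{S}(G)=\{N(u,G): u\in I(G)\}$, ordered by set inclusion. A threshold graph is a graph $G=(V,E)$ admitting a real $S$ and $w:V\to\mathbb{R}$ with $uv\in E$ iff $w(u)+w(v)\ge S$ (for distinct $u,v$). The threshold dimension $t(G)$ is the least $k$ such that there are threshold graphs $G_1,\dots,G_k$ on $V(G)$ with $E(G)=\bigcup_i E(G_i)$. For a poset $P=(S,\le_P)$, a linear extension is a total order $L$ on $S$ with $x\le_P y\Rightarrow x\le_L y$; a realizer is a set of linear extensions such that for every incomparable pair $x,y$ there are extensions $L_i,L_j$ in the set with $x<_{L_i}y$ and $y<_{L_j}x$; $\dim(P)$ is the minimum size of a realizer.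
   Formalization: The threshold S and the weights w of the threshold graphs whose edge sets cover $\overline{G}$ are rational instead of real. -}

module Defs where

open import Data.Nat using (ℕ; _≤_)
open import Data.Fin using (Fin; _≟_)
open import Data.Fin.Subset using (Subset; _⊆_)
open import Data.Bool using (Bool; true; false; not; if_then_else_)
open import Data.Vec using (tabulate)
open import Data.Rational using (ℚ) renaming (_≤_ to _≤ℚ_; _+_ to _+ℚ_)
open import Data.Product using (Σ; ∃; ∃-syntax; _×_)
open import Relation.Nullary using (¬_; does; yes; no)
open import Data.Sum using (_⊎_)
open import Data.Empty using (⊥-elim)
open import Relation.Binary.PropositionalEquality using (_≡_; _≢_; refl; cong) renaming (sym to ≡-sym)
open import Function.Bundles using (_⇔_)

record Graph (n : ℕ) : Set where
  field
    adj     : Fin n → Fin n → Bool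
    sym     : ∀ u v → adj u v ≡ adj v u
    irrefl  : ∀ u → adj u u ≡ false
open Graph public

Edge : ∀ {n} → Graph n → Fin n → Fin n → Set
Edge G u v = adj G u v ≡ true

complement : ∀ {n} → Graph n → Graph n
complement {n} G = record { adj = a ; sym = s ; irrefl = i }
  where
  a : Fin n → Fin n → Bool
  a u v = if does (u ≟ v) then false else not (adj G u v)
  s : ∀ u v → a u v ≡ a v u
  s u v with u ≟ v | v ≟ u
  ... | yes _ | yes _ = refl
  ... | yes p | no q = ⊥-elim (q (≡-sym p))
  ... | no q | yes p = ⊥-elim (q (≡-sym p))
  ... | no _ | no _ = cong not (sym G u v)
  i : ∀ u → a u u ≡ false
  i u with u ≟ u
  ... | yes _ = refl
  ... | no q = ⊥-elim (q refl)

-- G is split with respect to the partition given by inC: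
-- C(G) = {u | inC u ≡ true} is a clique, I(G) = {u | inC u ≡ false} is independent.
IsSplitPartition : ∀ {n} → Graph n → (Fin n → Bool) → Set
IsSplitPartition G inC =
  (∀ u v → u ≢ v → inC u ≡ true → inC v ≡ true → Edge G u v) ×
  (∀ u v → inC u ≡ false → inC v ≡ false → adj G u v ≡ false)

N : ∀ {n} → Graph n → Fin n → Subset n
N G u = tabulate (λ v → adj G u v)

-- The ground set S(G) = { N(u,G) : u ∈ I(G) } of the characteristic poset.
InS : ∀ {n} → Graph n → (Fin n → Bool) → Subset n → Set
InS G inC A = ∃[ u ] (inC u ≡ false × A ≡ N G u)

record LinearExtension {n} (G : Graph n) (inC : Fin n → Bool) : Set₁ where
  field
    _≤L_    : Subset n → Subset n → Set
    reflL   : ∀ x → InS G inC x → x ≤L x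
    antisymL : ∀ x y → InS G inC x → InS G inC y → x ≤L y → y ≤L x → x ≡ y
    transL  : ∀ x y z → InS G inC x → InS G inC y → InS G inC z → x ≤L y → y ≤L z → x ≤L z
    totalL  : ∀ x y → InS G inC x → InS G inC y → (x ≤L y) ⊎ (y ≤L x)
    extends : ∀ x y → InS G inC x → InS G inC y → x ⊆ y → x ≤L y
  _<L_ : Subset n → Subset n → Set
  x <L y = x ≤L y × x ≢ y

IsRealizer : ∀ {n} (G : Graph n) (inC : Fin n → Bool) (m : ℕ) → (Fin m → LinearExtension G inC) → Set
IsRealizer G inC m L =
  ∀ x y → InS G inC x → InS G inC y → ¬ (x ⊆ y) → ¬ (y ⊆ x) →
    (∃[ i ] LinearExtension._<L_ (L i) x y) × (∃[ j ] LinearExtension._<L_ (L j) y x)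

-- dim(P) ≤ k  (dim is the minimum size of a realizer)
DimCharPosetAtMost : ∀ {n} (G : Graph n) (inC : Fin n → Bool) → ℕ → Set₁
DimCharPosetAtMost G inC k =
  Σ ℕ λ m → m ≤ k × Σ (Fin m → LinearExtension G inC) λ L → IsRealizer G inC m L

IsThreshold : ∀ {n} → Graph n → Set
IsThreshold {n} G =
  Σ ℚ λ S → Σ (Fin n → ℚ) λ w → ∀ u v → u ≢ v → Edge G u v ⇔ (S ≤ℚ (w u +ℚ w v))

-- A family of k threshold graphs on V(G) whose edge sets union to E(G)  (witnesses t(G) ≤ k)
IsThresholdCover : ∀ {n} → Graph n → (k : ℕ) → (Fin k → Graph n) → Set
IsThresholdCover G k H =
  (∀ i → IsThreshold (H i)) × (∀ u v → Edge G u v ⇔ (∃[ i ] Edge (H i) u v))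

{-# OPTIONS --safe #-}
-- Each threshold graph Hᵢ of the cover, with weights wᵢ, gives a linear extension Lᵢ of
-- (S(G), ⊆): rank x by the largest wᵢ(u) over independent u with x ⊆ N(u), list larger
-- ranks first and break ties lexicographically. Enlarging x only removes such u, so Lᵢ
-- extends ⊆. If N(u) ⊈ N(v), take c ∈ N(u) ∖ N(v): c is in the clique, so vc is an edge of
-- the complement and lies in some Hᵢ. Every independent u' with N(u) ⊆ N(u') is adjacent
-- to c in G, so u'c ∉ Hᵢ and the threshold inequality forces wᵢ(u') < wᵢ(v). Hence N(v)
-- outranks N(u) and precedes it in Lᵢ, and the k extensions form a realizer.
module Submission where

open import Defs
open import Data.Bool using (Bool; true; false)
import Data.Bool as Bool
import Data.Bool.Properties as Bool
open import Data.Fin using (Fin)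
import Data.Fin as Fin
open import Data.Fin.Properties using (¬∀⟶∃¬)
open import Data.Fin.Subset using (Subset; _⊆_; _∈_; _∉_)
open import Data.Fin.Subset.Properties using (drop-∷-⊆; _⊆?_; _∈?_)
open import Data.List using (List; map; filter; allFin)
import Data.List.Membership.Propositional as List
open import Data.List.Membership.Propositional.Properties using (∈-map⁺; ∈-map⁻; ∈-filter⁺; ∈-filter⁻; ∈-allFin)
import Data.List.Relation.Binary.Subset.Propositional.Properties as List
import Data.List.Relation.Unary.All as All
open import Data.Nat using (ℕ)
import Data.Nat.Properties as ℕ
open import Data.Product using (∃-syntax; _×_; _,_; proj₁; proj₂; uncurry)
open import Data.Product.Relation.Binary.Lex.NonStrict using (×-totalOrder)
open import Data.Rational using (ℚ; 0ℚ; 1ℚ; -_; _-_; _+_) renaming (_≤_ to _≤ℚ_; _<_ to _<ℚ_; _<?_ to _<ℚ?_)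
import Data.Rational.Properties as ℚ
open import Data.Sum using (inj₁; inj₂)
open import Data.Unit using (tt)
open import Data.Vec using ([]; _∷_; here)
open import Data.Vec.Properties using ([]=⇒lookup; lookup⇒[]=; lookup∘tabulate)
open import Data.Vec.Relation.Binary.Lex.NonStrict as Lex using (Lex-≤; base; this; next)
open import Data.Vec.Relation.Binary.Pointwise.Inductive using (Pointwise-≡⇒≡)
open import Function using (id)
open import Function.Bundles using (_⇔_; Equivalence)
open import Level using (0ℓ)
open import Relation.Binary using (TotalOrder; DecTotalOrder)
import Relation.Binary.Construct.Flip.EqAndOrd as Flip
open import Relation.Binary.PropositionalEquality using (_≡_; _≢_; refl; trans; ≢-sym; subst)
  renaming (sym to ≡-sym)
open import Relation.Nullary using (¬_; yes; no; contradiction)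
open import Relation.Nullary.Decidable using (toWitness; _×-dec_; _→-dec_; decidable-stable)
open import Relation.Unary using (Decidable)

open import Data.List.Extrema (DecTotalOrder.totalOrder ℚ.≤-decTotalOrder)
  using (min; max; min≤xs; xs≤max; max<v⁺; max-mono-⊆)

module OrderPullback {n} {G : Graph n} {inC : Fin n → Bool} (T : TotalOrder 0ℓ 0ℓ 0ℓ)
  (f : Subset n → TotalOrder.Carrier T)
  (f-injective : ∀ {x y} → TotalOrder._≈_ T (f x) (f y) → x ≡ y)
  (f-monotone : ∀ {x y} → x ⊆ y → TotalOrder._≤_ T (f x) (f y))
  where
  open TotalOrder T using (_≈_; _≤_; antisym; total; module Eq) renaming (refl to ≤-refl; trans to ≤-trans)

  extension : LinearExtension G inC
  extension = record
    { _≤L_     = λ x y → f x ≤ f y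
    ; reflL    = λ _ _ → ≤-refl
    ; antisymL = λ _ _ _ _ fx≤fy fy≤fx → f-injective (antisym fx≤fy fy≤fx)
    ; transL   = λ _ _ _ _ _ _ → ≤-trans
    ; totalL   = λ x y _ _ → total (f x) (f y)
    ; extends  = λ _ _ _ _ → f-monotone
    }

  open LinearExtension extension using (_<L_)

  <⇒<L : ∀ {x y} → f x ≤ f y → ¬ f x ≈ f y → x <L y
  <⇒<L fx≤fy fx≉fy = fx≤fy , λ { refl → fx≉fy Eq.refl }

⊆⇒≤-lex : ∀ {n} {x y : Subset n} → x ⊆ y → Lex-≤ _≡_ Bool._≤_ x y
⊆⇒≤-lex {x = []}        {[]}        _   = base tt
⊆⇒≤-lex {x = false ∷ x} {true ∷ y}  _   = this (Bool.f≤t , λ ()) refl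
⊆⇒≤-lex {x = true ∷ x}  {false ∷ y} x⊆y with x⊆y here
... | ()
⊆⇒≤-lex {x = false ∷ x} {false ∷ y} x⊆y = next refl (⊆⇒≤-lex (drop-∷-⊆ x⊆y))
⊆⇒≤-lex {x = true ∷ x}  {true ∷ y}  x⊆y = next refl (⊆⇒≤-lex (drop-∷-⊆ x⊆y))

p-1<p : ∀ p → p - 1ℚ <ℚ p
p-1<p p = subst (p - 1ℚ <ℚ_) (ℚ.+-identityʳ p) (ℚ.+-monoʳ-< p -1<0)
  where
  -1<0 : - 1ℚ <ℚ 0ℚ
  -1<0 = toWitness {a? = - 1ℚ <ℚ? 0ℚ} _

<⇒≤∧≢ : ∀ {p q} → p <ℚ q → p ≤ℚ q × p ≢ q
<⇒≤∧≢ p<q = ℚ.<⇒≤ p<q , ℚ.<⇒≢ p<q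

≤∧≢⇒< : ∀ {p q} → p ≤ℚ q → p ≢ q → p <ℚ q
≤∧≢⇒< p≤q p≢q = ℚ.≰⇒> (λ q≤p → p≢q (ℚ.≤-antisym p≤q q≤p))

strictLowerBound : ∀ {n} (w : Fin n → ℚ) → ∃[ b ] ∀ u → b <ℚ w u
strictLowerBound {n} w = minimum - 1ℚ , λ u →
  ℚ.<-≤-trans (p-1<p minimum) (All.lookup (min≤xs 0ℚ (map w (allFin n))) (∈-map⁺ w (∈-allFin u)))
  where minimum = min 0ℚ (map w (allFin n))

module TopWeight {n} (G : Graph n) (inC : Fin n → Bool) (w : Fin n → ℚ) where

  Above : Subset n → Fin n → Set
  Above x u = inC u ≡ false × x ⊆ N G u

  above? : ∀ x → Decidable (Above x)
  above? x u = (inC u Bool.≟ false) ×-dec (x ⊆? N G u)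

  above : Subset n → List (Fin n)
  above x = filter (above? x) (allFin n)

  -- The value of max on an empty list; being strictly below every weight, it never
  -- decides a strict comparison (see topWeight<bound).
  floor : ℚ
  floor = proj₁ (strictLowerBound w)

  floor<weight : ∀ u → floor <ℚ w u
  floor<weight = proj₂ (strictLowerBound w)

  topWeight : Subset n → ℚ
  topWeight x = max floor (map w (above x))

  weight≤topWeight : ∀ {x u} → Above x u → w u ≤ℚ topWeight x
  weight≤topWeight {x} {u} x⊑u =
    All.lookup (xs≤max floor (map w (above x))) (∈-map⁺ w (∈-filter⁺ (above? x) (∈-allFin u) x⊑u))

  topWeight<bound : ∀ {x b} → (∀ {u} → Above x u → w u <ℚ b) → floor <ℚ b → topWeight x <ℚ b
  topWeight<bound {x} {b} below floor<b =
    uncurry ≤∧≢⇒< (max<v⁺ (<⇒≤∧≢ floor<b) (All.tabulate weight-below))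
    where
    weight-below : ∀ {q} → q List.∈ map w (above x) → q ≤ℚ b × q ≢ b
    weight-below q∈ with ∈-map⁻ w q∈
    ... | u , u∈ , refl = <⇒≤∧≢ (below (proj₂ (∈-filter⁻ (above? x) {xs = allFin n} u∈)))

  topWeight-antitone : ∀ {x y} → x ⊆ y → topWeight y ≤ℚ topWeight x
  topWeight-antitone {x} {y} x⊆y = max-mono-⊆ {xs = map w (above y)} {ys = map w (above x)} ℚ.≤-refl
    (List.map⁺ w (List.filter⁺′ (above? y) (above? x) y⊑u⇒x⊑u {allFin n} List.⊆-refl))
    where
    y⊑u⇒x⊑u : ∀ {u} → Above y u → Above x u
    y⊑u⇒x⊑u (u∈I , y⊆Nu) = u∈I , λ c∈x → y⊆Nu (x⊆y c∈x)

  Rank : TotalOrder 0ℓ 0ℓ 0ℓ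
  Rank = ×-totalOrder (Flip.decTotalOrder ℚ.≤-decTotalOrder) (Lex.≤-totalOrder Bool.≤-totalOrder Bool._≟_ n)

  rank : Subset n → TotalOrder.Carrier Rank
  rank x = topWeight x , x

  rank-injective : ∀ {x y} → TotalOrder._≈_ Rank (rank x) (rank y) → x ≡ y
  rank-injective (_ , x≋y) = Pointwise-≡⇒≡ x≋y

  rank-monotone : ∀ {x y} → x ⊆ y → TotalOrder._≤_ Rank (rank x) (rank y)
  rank-monotone {x} {y} x⊆y with topWeight x ℚ.≟ topWeight y
  ... | yes tx≡ty = inj₂ (tx≡ty , ⊆⇒≤-lex x⊆y)
  ... | no tx≢ty = inj₁ (topWeight-antitone x⊆y , tx≢ty)

  open OrderPullback {G = G} {inC = inC} Rank rank rank-injective rank-monotone public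
    using (extension)
  open OrderPullback {G = G} {inC = inC} Rank rank rank-injective rank-monotone using (<⇒<L)
  open LinearExtension extension using (_<L_)

  topWeight>⇒<L : ∀ {x y} → topWeight y <ℚ topWeight x → x <L y
  topWeight>⇒<L ty<tx =
    <⇒<L (inj₁ (ℚ.<⇒≤ ty<tx , tx≢ty)) (λ (tx≡ty , _) → tx≢ty tx≡ty)
    where tx≢ty = ≢-sym (ℚ.<⇒≢ ty<tx)

⊈⇒∃∈∖ : ∀ {n} {x y : Subset n} → ¬ x ⊆ y → ∃[ c ] c ∈ x × c ∉ y
⊈⇒∃∈∖ {n} {x} {y} x⊈y with ¬∀⟶∃¬ n (λ c → c ∈ x → c ∈ y) (λ c → (c ∈? x) →-dec (c ∈? y)) (λ x⊆y → x⊈y (x⊆y _))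
... | c , c∈x↛c∈y =
  c , decidable-stable (c ∈? x) (λ c∉x → c∈x↛c∈y (λ c∈x → contradiction c∈x c∉x)) , λ c∈y → c∈x↛c∈y (λ _ → c∈y)

module _ {n} (G : Graph n) {u c : Fin n} where

  ∈N⇒Edge : c ∈ N G u → Edge G u c
  ∈N⇒Edge c∈Nu = trans (≡-sym (lookup∘tabulate (adj G u) c)) ([]=⇒lookup c∈Nu)

  ∉N⇒nonadjacent : c ∉ N G u → adj G u c ≡ false
  ∉N⇒nonadjacent c∉Nu = Bool.¬-not λ uc → c∉Nu (lookup⇒[]= c _ (trans (lookup∘tabulate (adj G u) c) uc))

  nonadjacent⇒complement-Edge : u ≢ c → adj G u c ≡ false → Edge (complement G) u c
  nonadjacent⇒complement-Edge u≢c uc with u Fin.≟ c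
  ... | yes u≡c = contradiction u≡c u≢c
  ... | no _ rewrite uc = refl

  Edge⇒complement-nonadjacent : Edge G u c → adj (complement G) u c ≡ false
  Edge⇒complement-nonadjacent uc with u Fin.≟ c
  ... | yes _ = refl
  ... | no _ rewrite uc = refl

neighbour-of-independent∈C : ∀ {n} {G : Graph n} {inC : Fin n → Bool} → IsSplitPartition G inC →
  ∀ {u c} → inC u ≡ false → Edge G u c → inC c ≡ true
neighbour-of-independent∈C (_ , independent) {u} {c} u∈I uc =
  Bool.¬-not λ c∈I → Bool.not-¬ uc (independent u c u∈I c∈I)

I≢C : ∀ {n} (inC : Fin n → Bool) {a b} → inC a ≡ false → inC b ≡ true → a ≢ b
I≢C inC a∈I b∈C refl = Bool.not-¬ b∈C a∈I

threshold-weight-< : ∀ {n} {H : Graph n} {S : ℚ} {w : Fin n → ℚ} →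
  (∀ u v → u ≢ v → Edge H u v ⇔ (S ≤ℚ w u + w v)) →
  ∀ {u v c} → u ≢ c → v ≢ c → Edge H v c → ¬ Edge H u c → w u <ℚ w v
threshold-weight-< {w = w} threshold {u} {v} {c} u≢c v≢c vc ¬uc = ℚ.≰⇒> λ wv≤wu →
  ¬uc (Equivalence.from (threshold u c u≢c)
    (ℚ.≤-trans (Equivalence.to (threshold v c v≢c) vc) (ℚ.+-monoˡ-≤ (w c) wv≤wu)))

module CoveredComplement {n} {G : Graph n} {inC : Fin n → Bool} (split : IsSplitPartition G inC)
         {k} {H : Fin k → Graph n} (cover : IsThresholdCover (complement G) k H) where

  weight : Fin k → Fin n → ℚ
  weight i = proj₁ (proj₂ (proj₁ cover i))

  module Weighted (i : Fin k) = TopWeight G inC (weight i)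
  open Weighted using (topWeight; extension)

  topWeight-separates : ∀ {x y} → InS G inC x → InS G inC y → ¬ x ⊆ y →
    ∃[ i ] topWeight i x <ℚ topWeight i y
  topWeight-separates (u , u∈I , refl) (v , v∈I , refl) Nu⊈Nv with ⊈⇒∃∈∖ Nu⊈Nv
  ... | c , c∈Nu , c∉Nv = i , (begin-strict
      topWeight i (N G u)  <⟨ Weighted.topWeight<bound i below-v (Weighted.floor<weight i v) ⟩
      weight i v           ≤⟨ Weighted.weight≤topWeight i (v∈I , id) ⟩
      topWeight i (N G v)  ∎)
    where
    open ℚ.≤-Reasoning
    c∈C : inC c ≡ true
    c∈C = neighbour-of-independent∈C {G = G} split u∈I (∈N⇒Edge G c∈Nu)
    vc∈Hi : ∃[ i ] Edge (H i) v c
    vc∈Hi = Equivalence.to (proj₂ cover v c)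
      (nonadjacent⇒complement-Edge G (I≢C inC v∈I c∈C) (∉N⇒nonadjacent G c∉Nv))
    i = proj₁ vc∈Hi
    below-v : ∀ {u'} → Weighted.Above i (N G u) u' → weight i u' <ℚ weight i v
    below-v {u'} (u'∈I , Nu⊆Nu') = threshold-weight-< {H = H i} (proj₂ (proj₂ (proj₁ cover i)))
      (I≢C inC u'∈I c∈C) (I≢C inC v∈I c∈C) (proj₂ vc∈Hi)
      λ u'c∈Hi → Bool.not-¬ (Equivalence.from (proj₂ cover u' c) (i , u'c∈Hi))
                   (Edge⇒complement-nonadjacent G (∈N⇒Edge G (Nu⊆Nu' c∈Nu)))

  extension-separates : ∀ {x y} → InS G inC x → InS G inC y → ¬ y ⊆ x →
    ∃[ i ] LinearExtension._<L_ (extension i) x y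
  extension-separates x∈S y∈S y⊈x with topWeight-separates y∈S x∈S y⊈x
  ... | i , ty<tx = i , Weighted.topWeight>⇒<L i ty<tx

  extensions-realize : IsRealizer G inC k extension
  extensions-realize x y x∈S y∈S x⊈y y⊈x = extension-separates x∈S y∈S y⊈x , extension-separates y∈S x∈S x⊈y

theorem2 : ∀ {n} (G : Graph n) (inC : Fin n → Bool) → IsSplitPartition G inC →
    (k : ℕ) (H : Fin k → Graph n) → IsThresholdCover (complement G) k H →
    DimCharPosetAtMost G inC k
theorem2 G inC split k H cover = k , ℕ.≤-refl , Weighted.extension , extensions-realize
  where open CoveredComplement {G = G} split {H = H} cover
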